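{- Let $n$ be a positive integer. For any permutation $\sigma\in S_n$, there is exactly one $n$-th order Latin Square whose first (top) row, read from left to right, is $\sigma$ and all of whose column permutations avoid the pattern $123$.
   Context: An $n$-th order Latin Square is an $n\times n$ grid filled with the symbols $1,\dots,n$ such that each symbol appears exactly once in each row and each column. Each column, read from top to bottom, gives a permutation of $\{1,\dots,n\}$ (a column permutation). A permutation avoids the pattern $123$ if it has no subsequence of three entries in strictly increasing order. -}

module Defs where

open import Data.Nat using (ℕ; suc)
open import Data.Fin using (Fin; zero; _<_)
open import Data.Product using (Σ; _×_; ∃; ∃-syntax)
open import Relation.Binary.PropositionalEquality using (_≡_)
open import Relation.Nullary using (¬_)

ExactlyOne : ∀ {n} → (Fin n → Set) → Set
ExactlyOne {n} P = Σ (Fin n) λ x → P x × (∀ y → P y → y ≡ x)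

-- An n×n grid with symbols from Fin n (representing 1..n); L r c = entry in row r, column c.
Grid : ℕ → Set
Grid n = Fin n → Fin n → Fin n

IsLatinSquare : ∀ {n} → Grid n → Set
IsLatinSquare {n} L =
  (∀ (r s : Fin n) → ExactlyOne (λ c → L r c ≡ s)) ×
  (∀ (c s : Fin n) → ExactlyOne (λ r → L r c ≡ s))

IsPermutation : ∀ {n} → (Fin n → Fin n) → Set
IsPermutation {n} σ = ∀ (s : Fin n) → ExactlyOne (λ i → σ i ≡ s)

Contains123 : ∀ {n} → (Fin n → Fin n) → Set
Contains123 {n} p = ∃[ i ] ∃[ j ] ∃[ k ] (i < j × j < k × p i < p j × p j < p k)

Avoids123 : ∀ {n} → (Fin n → Fin n) → Set
Avoids123 p = ¬ Contains123 p

column : ∀ {n} → Grid n → Fin n → (Fin n → Fin n)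
column L c = λ r → L r c

Good : ∀ {m} → (Fin (suc m) → Fin (suc m)) → Grid (suc m) → Set
Good {m} σ L = IsLatinSquare L × (∀ c → L zero c ≡ σ c) × (∀ c → Avoids123 (column L c))

module Submission where

-- Symbols and rows are Fin N = {0, …, N-1} with N = m + 1.  The unique square
-- is the cyclic one, T r c = σ c - r (mod N): every column counts down from its
-- top symbol a = σ c to 0, wraps to N-1 and counts down to a+1, so it avoids 123.
--
-- Uniqueness is argued column by column for a Latin square L with top row σ and
-- 123-avoiding columns.
--  * In a 123-avoiding column, the entries before the largest symbol m and the
--    entries after the smallest symbol 0 strictly decrease (descent lemmas), so
--    along such a stretch an entry drops by at least the distance travelled
--    (decreasing-gap).
--  * Hence in a column with top a < m the symbol m sits in row at most a+1.  The
--    symbol m occupies every row once, so a pigeonhole induction on a places it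
--    in row exactly a+1; then rows 0..a read a, …, 0 and rows a+1..m read
--    m, …, a+1, i.e. the column of T.
--  * The single column with top m is then forced row by row, because a row of L
--    differs from the permutation T r in at most one position.

open import Defs
open import Data.Nat using (ℕ; suc; zero; _+_; _∸_; _≤_; _<_; _≟_; _≮_; _≤?_; z≤n; s≤s; z<s)
open import Data.Nat.Properties
open import Data.Nat.Induction using (<-rec)
open import Data.Fin using (Fin; toℕ; fromℕ; fromℕ<; inject₁) renaming (zero to fzero; suc to fsuc)
open import Data.Fin.Properties using (toℕ-injective; toℕ-fromℕ; toℕ-fromℕ<; toℕ<n; toℕ-inject₁) renaming (_≟_ to _≟ᶠ_)
open import Data.Product using (Σ; _×_; _,_; proj₁; proj₂)
open import Data.Empty using (⊥-elim)
open import Function using (_∘′_)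
open import Relation.Nullary using (yes; no; contradiction)
open import Relation.Binary.PropositionalEquality using (_≡_; _≢_; refl; sym; trans; cong; cong₂; subst)

module _ {n : ℕ} {B : Set} {f : Fin n → B} where

  exactlyOne-injective : (∀ s → ExactlyOne (λ i → f i ≡ s)) → ∀ {i j} → f i ≡ f j → i ≡ j
  exactlyOne-injective once {i} {j} fi≡fj = trans (unique i fi≡fj) (sym (unique j refl))
    where
    unique : ∀ k → f k ≡ f j → k ≡ proj₁ (once (f j))
    unique = proj₂ (proj₂ (once (f j)))

  exactlyOne-surjective : (∀ s → ExactlyOne (λ i → f i ≡ s)) → ∀ s → Σ (Fin n) (λ i → f i ≡ s)
  exactlyOne-surjective once s = proj₁ (once s) , proj₁ (proj₂ (once s))

  bijective-exactlyOne : (∀ {i j} → f i ≡ f j → i ≡ j) → (∀ s → Σ (Fin n) (λ i → f i ≡ s)) →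
                         ∀ s → ExactlyOne (λ i → f i ≡ s)
  bijective-exactlyOne inj surj s =
    proj₁ (surj s) , proj₂ (surj s) , λ j fj≡s → inj (trans fj≡s (sym (proj₂ (surj s))))

-- An injective row that agrees with a surjective row away from one position c₀
-- agrees with it at c₀ too: the value f c₀ must be taken by g somewhere.
agree-everywhere : ∀ {n} {B : Set} (f g : Fin n → B) (c₀ : Fin n) →
                   (∀ {i j} → f i ≡ f j → i ≡ j) → (∀ s → Σ (Fin n) (λ i → g i ≡ s)) →
                   (∀ c → c ≢ c₀ → f c ≡ g c) → f c₀ ≡ g c₀
agree-everywhere f g c₀ f-inj g-surj agree with g-surj (f c₀)
... | c , gc≡fc₀ with c ≟ᶠ c₀
...   | yes refl = sym gc≡fc₀
...   | no c≢c₀ = contradiction (f-inj (trans (agree c c≢c₀) gc≡fc₀)) c≢c₀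

module _ {n : ℕ} {p : Fin n → Fin n} (avoids : Avoids123 p) (p-inj : ∀ {i j} → p i ≡ p j → i ≡ j) where

  private
    distinct : ∀ {i j} → toℕ i < toℕ j → toℕ (p i) ≢ toℕ (p j)
    distinct i<j pi≡pj = <⇒≢ i<j (cong toℕ (p-inj (toℕ-injective pi≡pj)))

  descent-before : ∀ {i j k} → toℕ i < toℕ j → toℕ j < toℕ k →
                   toℕ (p j) < toℕ (p k) → toℕ (p j) < toℕ (p i)
  descent-before i<j j<k pj<pk =
    ≤∧≢⇒< (≮⇒≥ (λ pi<pj → avoids (_ , _ , _ , i<j , j<k , pi<pj , pj<pk))) (distinct i<j ∘′ sym)

  descent-after : ∀ {i j k} → toℕ i < toℕ j → toℕ j < toℕ k →
                  toℕ (p i) < toℕ (p j) → toℕ (p k) < toℕ (p j)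
  descent-after i<j j<k pi<pj =
    ≤∧≢⇒< (≮⇒≥ (λ pj<pk → avoids (_ , _ , _ , i<j , j<k , pi<pj , pj<pk))) (distinct j<k ∘′ sym)

decreasing-gap : ∀ {n} (g : Fin n → ℕ) (lo hi : ℕ) →
                 (∀ {i j} → lo ≤ toℕ i → toℕ i < toℕ j → toℕ j < hi → g j < g i) →
                 ∀ {i j} → lo ≤ toℕ i → toℕ i ≤ toℕ j → toℕ j < hi → g j + toℕ j ≤ g i + toℕ i
decreasing-gap {n} g lo hi decreasing {i} {j} lo≤i i≤j j<hi = go (toℕ j ∸ toℕ i) j (m∸n+n≡m i≤j) j<hi
  where
  open ≤-Reasoning
  go : ∀ d (k : Fin n) → d + toℕ i ≡ toℕ k → toℕ k < hi → g k + toℕ k ≤ g i + toℕ i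
  go zero    k       i≡k  _    = ≤-reflexive (cong (λ l → g l + toℕ l) (toℕ-injective (sym i≡k)))
  go (suc d) fzero   ()   _
  go (suc d) (fsuc k) d+i≡k k<hi = begin
    g (fsuc k) + suc (toℕ k) ≡⟨ +-suc (g (fsuc k)) (toℕ k) ⟩
    suc (g (fsuc k) + toℕ k) ≤⟨ +-monoˡ-≤ (toℕ k) drop ⟩
    g k′ + toℕ k             ≡⟨ cong (g k′ +_) (sym (toℕ-inject₁ k)) ⟩
    g k′ + toℕ k′            ≤⟨ go d k′ d+i≡k′ k′<hi ⟩
    g i + toℕ i              ∎
    where
    k′ : Fin n
    k′ = inject₁ k
    d+i≡k′ : d + toℕ i ≡ toℕ k′
    d+i≡k′ = trans (suc-injective d+i≡k) (sym (toℕ-inject₁ k))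
    k′<next : toℕ k′ < suc (toℕ k)
    k′<next = s≤s (≤-reflexive (toℕ-inject₁ k))
    k′<hi : toℕ k′ < hi
    k′<hi = <-trans k′<next k<hi
    drop : g (fsuc k) < g k′
    drop = decreasing (≤-trans lo≤i (subst (toℕ i ≤_) d+i≡k′ (m≤n+m (toℕ i) d))) k′<next k<hi

-- `Shift N r a x`: the symbol x lies r cyclic steps below a, i.e. x + r ≡ a (mod N)
-- for x, r, a < N.  Row r, column c of the cyclic square satisfies Shift N r (σ c).
data Shift (N r a x : ℕ) : Set where
  unwrapped : x + r ≡ a     → Shift N r a x
  wrapped   : x + r ≡ a + N → Shift N r a x

module _ {N : ℕ} where

  shift-swap : ∀ {r a x} → Shift N r a x → Shift N x a r
  shift-swap {r} {x = x} (unwrapped p) = unwrapped (trans (+-comm r x) p)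
  shift-swap {r} {x = x} (wrapped p)   = wrapped (trans (+-comm r x) p)

  private
    no-double-wrap : ∀ {x y r} → x < N → x + r ≢ y + r + N
    no-double-wrap {x} {y} {r} x<N eq = <-irrefl eq (begin-strict
      x + r     <⟨ +-monoˡ-< r x<N ⟩
      N + r     ≡⟨ +-comm N r ⟩
      r + N     ≤⟨ +-monoˡ-≤ N (m≤n+m r y) ⟩
      y + r + N ∎)
      where open ≤-Reasoning

    no-wrap-below : ∀ {a b} → a < N → a ≢ b + N
    no-wrap-below {a} {b} a<N a≡b+N = <-irrefl a≡b+N (<-≤-trans a<N (m≤n+m N b))

  shift-unique : ∀ {r a x y} → x < N → y < N → Shift N r a x → Shift N r a y → x ≡ y
  shift-unique {r} _   _   (unwrapped p) (unwrapped q) = +-cancelʳ-≡ r _ _ (trans p (sym q))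
  shift-unique {r} _   _   (wrapped p) (wrapped q) = +-cancelʳ-≡ r _ _ (trans p (sym q))
  shift-unique     x<N _   (wrapped p) (unwrapped q) = ⊥-elim (no-double-wrap x<N (trans p (cong (_+ N) (sym q))))
  shift-unique     _   y<N (unwrapped p) (wrapped q) = ⊥-elim (no-double-wrap y<N (trans q (cong (_+ N) (sym p))))

  shift-unique-source : ∀ {r a b x} → a < N → b < N → Shift N r a x → Shift N r b x → a ≡ b
  shift-unique-source _   _   (unwrapped p) (unwrapped q) = trans (sym p) q
  shift-unique-source _   _   (wrapped p) (wrapped q) = +-cancelʳ-≡ N _ _ (trans (sym p) q)
  shift-unique-source a<N _   (unwrapped p) (wrapped q) = ⊥-elim (no-wrap-below a<N (trans (sym p) q))
  shift-unique-source _   b<N (wrapped p) (unwrapped q) = ⊥-elim (no-wrap-below b<N (trans (sym q) p))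

  shift-down : ∀ {r a} → r < N → a < N → Σ ℕ (λ x → x < N × Shift N r a x)
  shift-down {r} {a} r<N a<N with r ≤? a
  ... | yes r≤a = a ∸ r , ≤-<-trans (m∸n≤m a r) a<N , unwrapped (m∸n+n≡m r≤a)
  ... | no r≰a = a + N ∸ r , wrapped<N , wrapped (m∸n+n≡m r≤a+N)
    where
    open ≤-Reasoning
    r≤a+N : r ≤ a + N
    r≤a+N = ≤-trans (<⇒≤ r<N) (m≤n+m N a)
    wrapped<N : a + N ∸ r < N
    wrapped<N = +-cancelʳ-< r _ N (begin-strict
      a + N ∸ r + r ≡⟨ m∸n+n≡m r≤a+N ⟩
      a + N         <⟨ +-monoˡ-< N (≰⇒> r≰a) ⟩
      r + N         ≡⟨ +-comm r N ⟩
      N + r         ∎)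

  shift-up : ∀ {r x} → r < N → x < N → Σ ℕ (λ a → a < N × Shift N r a x)
  shift-up {r} {x} r<N x<N with N ≤? x + r
  ... | no N≰x+r = x + r , ≰⇒> N≰x+r , unwrapped refl
  ... | yes N≤x+r = x + r ∸ N , source<N , wrapped (sym (m∸n+n≡m N≤x+r))
    where
    source<N : x + r ∸ N < N
    source<N = +-cancelʳ-< N _ N (subst (_< N + N) (sym (m∸n+n≡m N≤x+r)) (+-mono-< x<N r<N))

  shift-ascent : ∀ {i j a x y} → i < j → x < y → Shift N i a x → Shift N j a y →
                 x + i ≡ a × y + j ≡ a + N
  shift-ascent i<j x<y (unwrapped p) (wrapped q) = p , q
  shift-ascent i<j x<y (unwrapped p) (unwrapped q) = ⊥-elim (<-irrefl (trans p (sym q)) (+-mono-< x<y i<j))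
  shift-ascent i<j x<y (wrapped p) (wrapped q) = ⊥-elim (<-irrefl (trans p (sym q)) (+-mono-< x<y i<j))
  shift-ascent {a = a} i<j x<y (wrapped p) (unwrapped q) =
    ⊥-elim (m+n≮m a N (subst (_< a) p (subst (_ <_) q (+-mono-< x<y i<j))))

module CyclicSquare (m : ℕ) (σ : Fin (suc m) → Fin (suc m)) (σ-perm : IsPermutation σ) where

  N : ℕ
  N = suc m

  σ-injective : ∀ {c c′} → σ c ≡ σ c′ → c ≡ c′
  σ-injective = exactlyOne-injective σ-perm

  column-with-top : (k : ℕ) → k < N → Σ (Fin N) (λ c → toℕ (σ c) ≡ k)
  column-with-top k k<N with exactlyOne-surjective σ-perm (fromℕ< k<N)
  ... | c , σc≡k = c , trans (cong toℕ σc≡k) (toℕ-fromℕ< k<N)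

  T : Grid N
  T r c = fromℕ< (proj₁ (proj₂ (shift-down (toℕ<n r) (toℕ<n (σ c)))))

  T-shift : ∀ r c → Shift N (toℕ r) (toℕ (σ c)) (toℕ (T r c))
  T-shift r c = subst (Shift N (toℕ r) (toℕ (σ c))) (sym (toℕ-fromℕ< x<N)) shifted
    where
    x<N : proj₁ (shift-down (toℕ<n r) (toℕ<n (σ c))) < N
    x<N = proj₁ (proj₂ (shift-down (toℕ<n r) (toℕ<n (σ c))))
    shifted : Shift N (toℕ r) (toℕ (σ c)) (proj₁ (shift-down (toℕ<n r) (toℕ<n (σ c))))
    shifted = proj₂ (proj₂ (shift-down (toℕ<n r) (toℕ<n (σ c))))

  T-unique : ∀ r c s → Shift N (toℕ r) (toℕ (σ c)) (toℕ s) → T r c ≡ s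
  T-unique r c s shifted = toℕ-injective (shift-unique (toℕ<n (T r c)) (toℕ<n s) (T-shift r c) shifted)

  T-row-injective : ∀ r {c c′} → T r c ≡ T r c′ → c ≡ c′
  T-row-injective r {c} {c′} Trc≡Trc′ = σ-injective (toℕ-injective
    (shift-unique-source (toℕ<n (σ c)) (toℕ<n (σ c′)) (T-shift r c)
      (subst (Shift N (toℕ r) (toℕ (σ c′))) (cong toℕ (sym Trc≡Trc′)) (T-shift r c′))))

  T-row-surjective : ∀ r s → Σ (Fin N) (λ c → T r c ≡ s)
  T-row-surjective r s with shift-up (toℕ<n r) (toℕ<n s)
  ... | a , a<N , shifted with column-with-top a a<N
  ...   | c , σc≡a = c , T-unique r c s (subst (λ b → Shift N (toℕ r) b (toℕ s)) (sym σc≡a) shifted)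

  T-column-injective : ∀ c {r r′} → T r c ≡ T r′ c → r ≡ r′
  T-column-injective c {r} {r′} Trc≡Tr′c = toℕ-injective
    (shift-unique (toℕ<n r) (toℕ<n r′) (shift-swap (T-shift r c))
      (shift-swap (subst (Shift N (toℕ r′) (toℕ (σ c))) (cong toℕ (sym Trc≡Tr′c)) (T-shift r′ c))))

  T-column-surjective : ∀ c s → Σ (Fin N) (λ r → T r c ≡ s)
  T-column-surjective c s with shift-down (toℕ<n s) (toℕ<n (σ c))
  ... | r , r<N , shifted =
    fromℕ< r<N , T-unique (fromℕ< r<N) c s
      (subst (λ k → Shift N k (toℕ (σ c)) (toℕ s)) (sym (toℕ-fromℕ< r<N)) (shift-swap shifted))

  -- Each column of T is a, …, 0, m, …, a+1: an ascent pair (i, j) needs j wrapped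
  -- and a later ascent (j, k) needs j unwrapped, so there is no 123.
  T-avoids : ∀ c → Avoids123 (column T c)
  T-avoids c (i , j , k , i<j , j<k , Ti<Tj , Tj<Tk) =
    <-irrefl (trans (sym j-unwrapped) j-wrapped) (m<m+n (toℕ (σ c)) z<s)
    where
    j-wrapped : toℕ (T j c) + toℕ j ≡ toℕ (σ c) + N
    j-wrapped = proj₂ (shift-ascent i<j Ti<Tj (T-shift i c) (T-shift j c))
    j-unwrapped : toℕ (T j c) + toℕ j ≡ toℕ (σ c)
    j-unwrapped = proj₁ (shift-ascent j<k Tj<Tk (T-shift j c) (T-shift k c))

  T-good : Good σ T
  T-good = ( (λ r → bijective-exactlyOne (T-row-injective r) (T-row-surjective r))
           , (λ c → bijective-exactlyOne (T-column-injective c) (T-column-surjective c)) )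
         , (λ c → T-unique fzero c (σ c) (unwrapped (+-identityʳ (toℕ (σ c)))))
         , T-avoids

  module Rigidity (L : Grid N) (good : Good σ L) where

    v : Fin N → Fin N → ℕ
    v r c = toℕ (L r c)

    a : Fin N → ℕ
    a c = toℕ (σ c)

    row-injective : ∀ r {c c′} → L r c ≡ L r c′ → c ≡ c′
    row-injective r = exactlyOne-injective (proj₁ (proj₁ good) r)

    column-injective : ∀ c {r r′} → L r c ≡ L r′ c → r ≡ r′
    column-injective c = exactlyOne-injective (proj₂ (proj₁ good) c)

    v-column-injective : ∀ c {r r′} → v r c ≡ v r′ c → r ≡ r′
    v-column-injective c = column-injective c ∘′ toℕ-injective

    v-top : ∀ c → v fzero c ≡ a c
    v-top c = cong toℕ (proj₁ (proj₂ good) c)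

    maxRow : Fin N → Fin N
    maxRow c = proj₁ (proj₂ (proj₁ good) c (fromℕ m))

    L-maxRow : ∀ c → L (maxRow c) c ≡ fromℕ m
    L-maxRow c = proj₁ (proj₂ (proj₂ (proj₁ good) c (fromℕ m)))

    v-maxRow : ∀ c → v (maxRow c) c ≡ m
    v-maxRow c = trans (cong toℕ (L-maxRow c)) (toℕ-fromℕ m)

    maxRow-injective : ∀ {c c′} → maxRow c ≡ maxRow c′ → c ≡ c′
    maxRow-injective {c} {c′} same = row-injective (maxRow c)
      (trans (L-maxRow c) (sym (subst (λ r → L r c′ ≡ fromℕ m) (sym same) (L-maxRow c′))))

    decreasing-above-max : ∀ c {i j} → 0 ≤ toℕ i → toℕ i < toℕ j → toℕ j < toℕ (maxRow c) → v j c < v i c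
    decreasing-above-max c {i} {j} _ i<j j<max =
      descent-before (proj₂ (proj₂ good) c) (column-injective c) {i} {j} {maxRow c} i<j j<max
        (subst (v j c <_) (sym (v-maxRow c)) vj<m)
      where
      vj<m : v j c < m
      vj<m = ≤∧≢⇒< (≤-pred (toℕ<n (L j c)))
        (λ vj≡m → <⇒≢ j<max (cong toℕ (v-column-injective c (trans vj≡m (sym (v-maxRow c))))))

    head-gap : ∀ c {j} → toℕ j < toℕ (maxRow c) → v j c + toℕ j ≤ a c
    head-gap c {j} j<max =
      subst (v j c + toℕ j ≤_) (trans (+-identityʳ (v fzero c)) (v-top c))
        (decreasing-gap (λ r → v r c) 0 (toℕ (maxRow c)) (decreasing-above-max c) {fzero} {j} z≤n z≤n j<max)

    maxRow-bound : ∀ c → toℕ (maxRow c) ≤ suc (a c)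
    maxRow-bound c = ≮⇒≥ (λ late → 1+n≰n (head-length late))
      where
      head-length : ∀ {k} → k < toℕ (maxRow c) → k ≤ a c
      head-length {k} k<max = ≤-trans (subst (_≤ v (fromℕ< k<N) c + toℕ (fromℕ< k<N)) (toℕ-fromℕ< k<N)
                                              (m≤n+m _ _))
                                      (head-gap c (subst (_< toℕ (maxRow c)) (sym (toℕ-fromℕ< k<N)) k<max))
        where
        k<N : k < N
        k<N = <-trans k<max (toℕ<n (maxRow c))

    maxRow-nonzero : ∀ c → a c < m → 0 < toℕ (maxRow c)
    maxRow-nonzero c a<m = ≤∧≢⇒< z≤n (λ 0≡max → <⇒≢ a<m
      (trans (sym (v-top c)) (trans (cong (λ r → v r c) (toℕ-injective 0≡max)) (v-maxRow c))))

    -- Pigeonhole: the columns with tops 0, 1, …, k hold m in rows 1, …, k + 1.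
    maxRow-position : ∀ c → a c < m → toℕ (maxRow c) ≡ suc (a c)
    maxRow-position c = <-rec P step (a c) c refl
      where
      P : ℕ → Set
      P k = ∀ c → a c ≡ k → k < m → toℕ (maxRow c) ≡ suc k
      step : ∀ k → (∀ {k′} → k′ < k → P k′) → P k
      step k earlier c ac≡k k<m =
        ≤-antisym (subst (λ b → toℕ (maxRow c) ≤ suc b) ac≡k (maxRow-bound c)) (≮⇒≥ too-early)
        where
        too-early : toℕ (maxRow c) ≮ suc k
        too-early max≤k = <-irrefl (sym (trans (sym ac≡k) (trans (cong a c≡c′) ac′≡t′))) t′<k
          where
          t t′ : ℕ
          t = toℕ (maxRow c)
          t′ = t ∸ 1
          suc-t′ : suc t′ ≡ t
          suc-t′ = trans (+-comm 1 t′) (m∸n+n≡m (maxRow-nonzero c (subst (_< m) (sym ac≡k) k<m)))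
          t′<k : t′ < k
          t′<k = subst (_≤ k) (sym suc-t′) (≤-pred max≤k)
          t′<N : t′ < N
          t′<N = <-trans t′<k (<-trans k<m (n<1+n m))
          c′ : Fin N
          c′ = proj₁ (column-with-top t′ t′<N)
          ac′≡t′ : a c′ ≡ t′
          ac′≡t′ = proj₂ (column-with-top t′ t′<N)
          c≡c′ : c ≡ c′
          c≡c′ = maxRow-injective (toℕ-injective
                   (trans (sym suc-t′) (sym (earlier t′<k c′ ac′≡t′ (<-trans t′<k k<m)))))

    module RegularColumn (c : Fin N) (a<m : a c < m) where

      maxRow≡ : toℕ (maxRow c) ≡ suc (a c)
      maxRow≡ = maxRow-position c a<m

      a<N : a c < N
      a<N = <-trans a<m (n<1+n m)

      -- the row a c, which will hold the symbol 0
      pivot : Fin N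
      pivot = fromℕ< a<N

      toℕ-pivot : toℕ pivot ≡ a c
      toℕ-pivot = toℕ-fromℕ< a<N

      head-rows : ∀ r → toℕ r ≤ a c → v r c + toℕ r ≡ a c
      head-rows r r≤a = ≤-antisym (head-gap c (below-max r≤a)) a≤
        where
        below-max : ∀ {j} → toℕ j ≤ a c → toℕ j < toℕ (maxRow c)
        below-max j≤a = subst (_ <_) (sym maxRow≡) (s≤s j≤a)
        a≤ : a c ≤ v r c + toℕ r
        a≤ = ≤-trans (subst (_≤ v pivot c + toℕ pivot) toℕ-pivot (m≤n+m _ _))
               (decreasing-gap (λ r → v r c) 0 (toℕ (maxRow c)) (decreasing-above-max c)
                  z≤n (subst (toℕ r ≤_) (sym toℕ-pivot) r≤a) (below-max (≤-reflexive toℕ-pivot)))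

      small-symbols-on-top : ∀ r → v r c ≤ a c → toℕ r ≤ a c
      small-symbols-on-top r v≤a = subst (_≤ a c) (cong toℕ r′≡r) r′≤a
        where
        r′<N : a c ∸ v r c < N
        r′<N = ≤-<-trans (m∸n≤m (a c) (v r c)) a<N
        r′ : Fin N
        r′ = fromℕ< r′<N
        r′≤a : toℕ r′ ≤ a c
        r′≤a = subst (_≤ a c) (sym (toℕ-fromℕ< r′<N)) (m∸n≤m (a c) (v r c))
        r′≡r : r′ ≡ r
        r′≡r = v-column-injective c (+-cancelʳ-≡ (a c ∸ v r c) _ _
          (trans (subst (λ k → v r′ c + k ≡ a c) (toℕ-fromℕ< r′<N) (head-rows r′ r′≤a))
                 (sym (m+[n∸m]≡n v≤a))))

      late-symbols-large : ∀ r → a c < toℕ r → a c < v r c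
      late-symbols-large r a<r = ≰⇒> (λ v≤a → <⇒≱ a<r (small-symbols-on-top r v≤a))

      decreasing-below-pivot : ∀ {i j} → suc (a c) ≤ toℕ i → toℕ i < toℕ j → toℕ j < N → v j c < v i c
      decreasing-below-pivot {i} {j} a<i i<j _ =
        descent-after (proj₂ (proj₂ good) c) (column-injective c) {pivot} {i} {j}
          (subst (_< toℕ i) (sym toℕ-pivot) a<i) i<j
          (≤-<-trans (≤-trans (m≤m+n (v pivot c) (toℕ pivot)) (≤-reflexive (head-rows pivot (≤-reflexive toℕ-pivot))))
                     (late-symbols-large i a<i))

      tail-rows : ∀ r → a c < toℕ r → v r c + toℕ r ≡ a c + N
      tail-rows r a<r = ≤-antisym upper lower
        where
        open ≤-Reasoning
        gap : ∀ {i j} → suc (a c) ≤ toℕ i → toℕ i ≤ toℕ j → v j c + toℕ j ≤ v i c + toℕ i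
        gap {i} {j} a<i i≤j =
          decreasing-gap (λ r → v r c) (suc (a c)) N decreasing-below-pivot a<i i≤j (toℕ<n j)
        upper : v r c + toℕ r ≤ a c + N
        upper = begin
          v r c + toℕ r                     ≤⟨ gap (≤-reflexive (sym maxRow≡)) (subst (_≤ toℕ r) (sym maxRow≡) a<r) ⟩
          v (maxRow c) c + toℕ (maxRow c)   ≡⟨ cong₂ _+_ (v-maxRow c) maxRow≡ ⟩
          m + suc (a c)                     ≡⟨ +-comm m (suc (a c)) ⟩
          suc (a c) + m                     ≡⟨ sym (+-suc (a c) m) ⟩
          a c + N                           ∎
        lower : a c + N ≤ v r c + toℕ r
        lower = begin
          a c + N                           ≡⟨ +-suc (a c) m ⟩
          suc (a c) + m                     ≤⟨ +-mono-≤ (late-symbols-large (fromℕ m) a<last) (≤-reflexive (sym (toℕ-fromℕ m))) ⟩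
          v (fromℕ m) c + toℕ (fromℕ m)     ≤⟨ gap a<r (subst (toℕ r ≤_) (sym (toℕ-fromℕ m)) (≤-pred (toℕ<n r))) ⟩
          v r c + toℕ r                     ∎
          where
          a<last : a c < toℕ (fromℕ m)
          a<last = subst (a c <_) (sym (toℕ-fromℕ m)) a<m

      column-shift : ∀ r → Shift N (toℕ r) (a c) (v r c)
      column-shift r with toℕ r ≤? a c
      ... | yes r≤a = unwrapped (head-rows r r≤a)
      ... | no r≰a = wrapped (tail-rows r (≰⇒> r≰a))

    regular : ∀ c → a c ≢ m → a c < m
    regular c ac≢m = ≤∧≢⇒< (≤-pred (toℕ<n (σ c))) ac≢m

    matches-regular : ∀ c → a c ≢ m → ∀ r → L r c ≡ T r c
    matches-regular c ac≢m r = sym (T-unique r c (L r c) (RegularColumn.column-shift c (regular c ac≢m) r))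

    -- The remaining column, with top m, is forced by the rows.
    L-matches-T : ∀ r c → L r c ≡ T r c
    L-matches-T r c with a c ≟ m
    ... | no ac≢m = matches-regular c ac≢m r
    ... | yes ac≡m = agree-everywhere (L r) (T r) c (row-injective r) (T-row-surjective r) other-columns
      where
      other-columns : ∀ c′ → c′ ≢ c → L r c′ ≡ T r c′
      other-columns c′ c′≢c =
        matches-regular c′ (λ ac′≡m → c′≢c (σ-injective (toℕ-injective (trans ac′≡m (sym ac≡m))))) r

proposition3 : (m : ℕ) (σ : Fin (suc m) → Fin (suc m)) → IsPermutation σ →
    Σ (Grid (suc m)) (λ L → Good σ L × (∀ L′ → Good σ L′ → ∀ r c → L′ r c ≡ L r c))
proposition3 m σ σ-perm = T , T-good , λ L′ good′ → Rigidity.L-matches-T L′ good′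
  where open CyclicSquare m σ σ-perm
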